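{- Every finite $4$-connected configuration $C$ (with $n\ge 1$ cells) is strongly embroiderable (and hence embroiderable).
   Context: The fabric is modelled by $\mathbb R^2$, the holes being the points of $\mathbb Z^2$ (called vertices). A cell is a square $[a,a+1]\times[b,b+1]$ with $(a,b)\in\mathbb Z^2$; its four corners are its vertices. A configuration is a finite set of cells. Two vertices are adjacent if they are at distance $1$. Each cell has two diagonals: the lower diagonal joins its top-right corner to its bottom-left corner, the upper diagonal joins its top-left corner to its bottom-right corner. A $4$-path from a cell $p$ to a cell $p'$ is a finite sequence of cells $p=p_0,\dots,p_m=p'$ such that $p_{i-1}$ and $p_i$ share at least one edge (a common side of length $1$) for each $i$. A configuration $C$ is $4$-connected if any two cells of $C$ are joined by a $4$-path consisting of cells of $C$. An embroidery of a configuration $C$ with $n$ cells is a sequence of points $x_0,x_1,\dots,x_{4n-1}\in\mathbb Z^2$ such that: the front stitches $[x_{2k},x_{2k+1}]$ ($0\le k\le 2n-1$) are exactly the $2n$ diagonals of the cells of $C$, each diagonal occurring exactly once (traversed in either direction); the back stitches $[x_{2k+1},x_{2k+2}]$ ($0\le k\le 2n-2$) satisfy $x_{2k+1}\neq x_{2k+2}$; and for every cell of $C$ its lower diagonal occurs (as a front stitch) before its upper diagonal. The thread length is the sum of the lengths of all front and back stitches; it is always at least $2n\sqrt2+(2n-1)$. The configuration $C$ is embroiderable if it admits an embroidery of thread length $2n(1+\sqrt2)-1$, i.e. every back stitch joins two adjacent vertices. It is strongly embroiderable if it admits an embroidery in which every back stitch joins two adjacent vertices and moreover $x_{4n-1}$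 is adjacent to $x_0$ (so that the thread can return to its starting point with one more unit back stitch, total length $2n(1+\sqrt2)$). -}

module Defs where

open import Data.Nat using (ℕ; _<_; _*_)
open import Data.Integer as ℤ using (ℤ; +_)
open import Data.Product using (_×_; _,_; proj₁; proj₂; Σ; ∃; ∃-syntax)
open import Data.Sum using (_⊎_)
open import Data.Empty using (⊥)
open import Data.Fin using (Fin; toℕ)
open import Data.List using (List; []; _∷_; length; lookup)
open import Data.List.Membership.Propositional using (_∈_)
open import Data.List.Relation.Unary.Linked using (Linked)
open import Data.List.Relation.Unary.Unique.Propositional using (Unique)
open import Relation.Binary.PropositionalEquality using (_≡_; _≢_)
open import Relation.Binary.Construct.Closure.ReflexiveTransitive using (Star)

-- Vertices (holes) are points of ℤ².
Point : Set
Point = ℤ × ℤ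

-- A cell [a,a+1]×[b,b+1] is represented by its bottom-left corner (a,b).
Cell : Set
Cell = ℤ × ℤ

Configuration : Set
Configuration = Σ (List Cell) Unique

cells : Configuration → List Cell
cells = proj₁

size : Configuration → ℕ
size C = length (cells C)

Adjacent : Point → Point → Set
Adjacent (x , y) (x' , y') =
  (x ℤ.- x') ℤ.* (x ℤ.- x') ℤ.+ (y ℤ.- y') ℤ.* (y ℤ.- y') ≡ + 1

-- A (directed) segment between two vertices; [p,q] as a set is unordered.
Segment : Set
Segment = Point × Point

SameSegment : Segment → Segment → Set
SameSegment (p , q) (p' , q') = (p ≡ p' × q ≡ q') ⊎ (p ≡ q' × q ≡ p')

bottomLeft bottomRight topLeft topRight : Cell → Point
bottomLeft  (a , b) = (a , b)
bottomRight (a , b) = (a ℤ.+ + 1 , b)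
topLeft     (a , b) = (a , b ℤ.+ + 1)
topRight    (a , b) = (a ℤ.+ + 1 , b ℤ.+ + 1)

lowerDiag : Cell → Segment
lowerDiag c = (topRight c , bottomLeft c)

upperDiag : Cell → Segment
upperDiag c = (topLeft c , bottomRight c)

IsEdgeOf : Segment → Cell → Set
IsEdgeOf e c =
  SameSegment e (bottomLeft c , bottomRight c) ⊎
  SameSegment e (bottomRight c , topRight c) ⊎
  SameSegment e (topRight c , topLeft c) ⊎
  SameSegment e (topLeft c , bottomLeft c)

ShareEdge : Cell → Cell → Set
ShareEdge p q = ∃[ e ] (IsEdgeOf e p × IsEdgeOf e q)

Step4 : Configuration → Cell → Cell → Set
Step4 C p q = p ∈ cells C × q ∈ cells C × ShareEdge p q

FourConnected : Configuration → Set
FourConnected C = ∀ {p q} → p ∈ cells C → q ∈ cells C → Star (Step4 C) p q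

-- The sequence x₀,…,x_{4n-1} is given by its list of front stitches
-- S = [(x₀,x₁), (x₂,x₃), …]; the k-th element is (x_{2k}, x_{2k+1}).
record IsEmbroidery (C : Configuration) (S : List Segment) : Set where
  field
    len : length S ≡ 2 * size C
    stitchIsDiagonal : ∀ (i : Fin (length S)) → ∃[ c ] (c ∈ cells C ×
      (SameSegment (lookup S i) (lowerDiag c) ⊎ SameSegment (lookup S i) (upperDiag c)))
    lowerOnce : ∀ c → c ∈ cells C → ∃[ i ] (SameSegment (lookup S i) (lowerDiag c) ×
      (∀ j → SameSegment (lookup S j) (lowerDiag c) → j ≡ i))
    upperOnce : ∀ c → c ∈ cells C → ∃[ i ] (SameSegment (lookup S i) (upperDiag c) ×
      (∀ j → SameSegment (lookup S j) (upperDiag c) → j ≡ i))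
    backNonDegenerate : Linked (λ s t → proj₂ s ≢ proj₁ t) S
    lowerBeforeUpper : ∀ c → c ∈ cells C → ∀ (i j : Fin (length S)) →
      SameSegment (lookup S i) (lowerDiag c) →
      SameSegment (lookup S j) (upperDiag c) → toℕ i < toℕ j

UnitBackStitches : List Segment → Set
UnitBackStitches S = Linked (λ s t → Adjacent (proj₂ s) (proj₁ t)) S

lastOf : Segment → List Segment → Segment
lastOf s []       = s
lastOf s (t ∷ ts) = lastOf t ts

Closes : List Segment → Set
Closes []       = ⊥
Closes (s ∷ ss) = Adjacent (proj₂ (lastOf s ss)) (proj₁ s)

Embroiderable : Configuration → Set
Embroiderable C = ∃[ S ] (IsEmbroidery C S × UnitBackStitches S)

StronglyEmbroiderable : Configuration → Set
StronglyEmbroiderable C = ∃[ S ] (IsEmbroidery C S × UnitBackStitches S × Closes S)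

module Submission where

-- Call the two endpoints of the lower diagonal of a cell its P-corners and
-- the two endpoints of its upper diagonal its Q-corners.  Every P-corner of a
-- cell is adjacent to every Q-corner of it, and when two distinct cells d, c
-- share an edge, that edge joins a P-corner of c which is a Q-corner of d to a
-- Q-corner of c which is a P-corner of d.
--
-- A tour is a list of oriented diagonals (stitches) in which consecutive
-- stitches are joined by unit back stitches, the stitch after a lower diagonal
-- starts at a Q-corner of its cell, the last stitch is an upper diagonal whose
-- end is adjacent to the first start, and every cell occurs through its lower
-- diagonal followed later by its upper one, each exactly once.  The two
-- diagonals of a single cell form a tour.  If d is in a tour and its neighbour c
-- is not, inserting the two diagonals of c right after the lower diagonal of d,
-- entering and leaving through the shared edge, gives again a tour.  Following
-- 4-paths from one cell to every other cell of a 4-connected configuration we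
-- grow a tour covering the whole configuration; reading off its stitches gives
-- a strong embroidery, and forgetting the closing condition an embroidery.

open import Defs
open import Data.Nat as ℕ using (suc; _≥_; _≤_; _<_; z≤n; s≤s)
import Data.Nat.Properties as ℕP
open import Data.Integer as ℤ using (ℤ; +_)
import Data.Integer.Properties as ℤP
open import Data.Integer.Solver using (module +-*-Solver)
open import Algebra.Properties.AbelianGroup ℤP.+-0-abelianGroup using (∙-cancelʳ)
open import Data.Bool using (Bool; true; false; not)
import Data.Bool.Properties as BoolP
open import Data.Product using (_×_; _,_; proj₁; proj₂; Σ; ∃-syntax)
open import Data.Product.Properties using (≡-dec)
open import Data.Sum as Sum using (_⊎_; inj₁; inj₂)
open import Data.Empty using (⊥; ⊥-elim)
open import Data.Unit using (⊤; tt)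
open import Data.Fin as Fin using (Fin; toℕ; cast)
open import Data.Fin.Properties using (toℕ-injective; toℕ-cast; cast-involutive)
open import Data.List using (List; []; _∷_; length; lookup; map; _++_)
open import Data.List.Properties using (length-map)
open import Data.List.Membership.Propositional using (_∈_)
open import Data.List.Membership.Propositional.Properties using (∈-∃++; ∈-lookup; ∈-map⁻)
open import Data.List.Relation.Unary.Any as Any using (Any; here; there; any?)
open import Data.List.Relation.Unary.Any.Properties as AnyP using (lookup-index)
open import Data.List.Relation.Unary.All as All using (All; []; _∷_)
import Data.List.Relation.Unary.All.Properties as AllP
open import Data.List.Relation.Unary.AllPairs using (AllPairs; []; _∷_)
import Data.List.Relation.Unary.AllPairs.Properties as AllPairsP
open import Data.List.Relation.Unary.Linked as Linked using (Linked; [-]; _∷_)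
open import Data.List.Relation.Unary.Unique.Propositional using (Unique)
open import Relation.Binary.PropositionalEquality
open import Relation.Binary.Construct.Closure.ReflexiveTransitive using (Star; ε; _◅_)
open import Relation.Nullary using (¬_; Dec; yes; no)

open +-*-Solver using (solve; _:=_; _:+_; _:-_; _:*_; con)

not-both-successors : ∀ u v → u ≡ v ℤ.+ + 1 → u ℤ.+ + 1 ≡ v → ⊥
not-both-successors u v u≡v+1 u+1≡v = 2≢0 (begin
      + 2                             ≡⟨ solve 1 (λ v → con (+ 2) := ((v :+ con (+ 1)) :+ con (+ 1)) :- v) refl v ⟩
      ((v ℤ.+ + 1) ℤ.+ + 1) ℤ.- v     ≡⟨ cong (λ w → (w ℤ.+ + 1) ℤ.- v) (sym u≡v+1) ⟩
      (u ℤ.+ + 1) ℤ.- v               ≡⟨ cong (ℤ._- v) u+1≡v ⟩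
      v ℤ.- v                         ≡⟨ ℤP.+-inverseʳ v ⟩
      + 0                             ∎)
  where
    open ≡-Reasoning
    2≢0 : + 2 ≢ + 0
    2≢0 ()

δ σ : Point → ℤ
δ (x , y) = x ℤ.- y
σ (x , y) = x ℤ.+ y

δσ-injective : ∀ p p' → δ p ≡ δ p' → σ p ≡ σ p' → p ≡ p'
δσ-injective (a , b) (a' , b') δ≡ σ≡ = cong₂ _,_ a≡a' b≡b'
  where
    a≡a' : a ≡ a'
    a≡a' = ℤP.*-cancelˡ-≡ (+ 2) a a' (begin
      + 2 ℤ.* a                   ≡⟨ solve 2 (λ a b → con (+ 2) :* a := (a :- b) :+ (a :+ b)) refl a b ⟩
      (a ℤ.- b) ℤ.+ (a ℤ.+ b)     ≡⟨ cong₂ ℤ._+_ δ≡ σ≡ ⟩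
      (a' ℤ.- b') ℤ.+ (a' ℤ.+ b') ≡⟨ solve 2 (λ a b → (a :- b) :+ (a :+ b) := con (+ 2) :* a) refl a' b' ⟩
      + 2 ℤ.* a'                  ∎)
      where open ≡-Reasoning
    b≡b' : b ≡ b'
    b≡b' = begin
      b                     ≡⟨ solve 2 (λ a b → b := (a :+ b) :- a) refl a b ⟩
      (a ℤ.+ b) ℤ.- a       ≡⟨ cong₂ ℤ._-_ σ≡ a≡a' ⟩
      (a' ℤ.+ b') ℤ.- a'    ≡⟨ solve 2 (λ a b → (a :+ b) :- a := b) refl a' b' ⟩
      b'                    ∎
      where open ≡-Reasoning

adjacent-sym : ∀ p q → Adjacent p q → Adjacent q p
adjacent-sym (x , y) (x' , y') pq = trans
  (solve 4 (λ x y x' y' → (x' :- x) :* (x' :- x) :+ (y' :- y) :* (y' :- y)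
                      := (x :- x') :* (x :- x') :+ (y :- y') :* (y :- y')) refl x y x' y')
  pq

adjacent-irreflexive : ∀ p → ¬ Adjacent p p
adjacent-irreflexive (x , y) pp with
  trans (solve 2 (λ x y → con (+ 0) := (x :- x) :* (x :- x) :+ (y :- y) :* (y :- y)) refl x y) pp
... | ()

adjacent-right : ∀ a b → Adjacent (a , b) (a ℤ.+ + 1 , b)
adjacent-right a b = solve 2 (λ a b →
  (a :- (a :+ con (+ 1))) :* (a :- (a :+ con (+ 1))) :+ (b :- b) :* (b :- b) := con (+ 1)) refl a b

adjacent-up : ∀ a b → Adjacent (a , b) (a , b ℤ.+ + 1)
adjacent-up a b = solve 2 (λ a b →
  (a :- a) :* (a :- a) :+ (b :- (b :+ con (+ 1))) :* (b :- (b :+ con (+ 1))) := con (+ 1)) refl a b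

IsP IsQ : Cell → Point → Set
IsP c p = p ≡ bottomLeft c ⊎ p ≡ topRight c
IsQ c q = q ≡ topLeft c ⊎ q ≡ bottomRight c

P-Q-adjacent : ∀ c {p q} → IsP c p → IsQ c q → Adjacent p q
P-Q-adjacent (a , b) (inj₁ refl) (inj₁ refl) = adjacent-up a b
P-Q-adjacent (a , b) (inj₁ refl) (inj₂ refl) = adjacent-right a b
P-Q-adjacent (a , b) (inj₂ refl) (inj₁ refl) =
  adjacent-sym (a , b ℤ.+ + 1) (a ℤ.+ + 1 , b ℤ.+ + 1) (adjacent-right a (b ℤ.+ + 1))
P-Q-adjacent (a , b) (inj₂ refl) (inj₂ refl) =
  adjacent-sym (a ℤ.+ + 1 , b) (a ℤ.+ + 1 , b ℤ.+ + 1) (adjacent-up (a ℤ.+ + 1) b)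

Q-P-adjacent : ∀ c {q p} → IsQ c q → IsP c p → Adjacent q p
Q-P-adjacent c {q} {p} qc pc = adjacent-sym p q (P-Q-adjacent c pc qc)

δ-P : ∀ c {p} → IsP c p → δ p ≡ δ c
δ-P (a , b) (inj₁ refl) = refl
δ-P (a , b) (inj₂ refl) =
  solve 2 (λ a b → (a :+ con (+ 1)) :- (b :+ con (+ 1)) := a :- b) refl a b

σ-Q : ∀ c {q} → IsQ c q → σ q ≡ σ c ℤ.+ + 1
σ-Q (a , b) (inj₁ refl) =
  solve 2 (λ a b → a :+ (b :+ con (+ 1)) := (a :+ b) :+ con (+ 1)) refl a b
σ-Q (a , b) (inj₂ refl) =
  solve 2 (λ a b → (a :+ con (+ 1)) :+ b := (a :+ b) :+ con (+ 1)) refl a b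

same-corners⇒same-cell : ∀ d c {p q} → IsP d p → IsP c p → IsQ d q → IsQ c q → d ≡ c
same-corners⇒same-cell d c pd pc qd qc = δσ-injective d c
  (trans (sym (δ-P d pd)) (δ-P c pc))
  (∙-cancelʳ (+ 1) (σ d) (σ c) (trans (sym (σ-Q d qd)) (σ-Q c qc)))

swap-segment : ∀ {e p q} → SameSegment e (p , q) → SameSegment e (q , p)
swap-segment (inj₁ x) = inj₂ x
swap-segment (inj₂ x) = inj₁ x

side-corners : ∀ c {e} → IsEdgeOf e c →
  ∃[ p ] ∃[ q ] (IsP c p × IsQ c q × SameSegment e (p , q))
side-corners c (inj₁ s)                = _ , _ , inj₁ refl , inj₂ refl , s
side-corners c (inj₂ (inj₁ s))         = _ , _ , inj₂ refl , inj₂ refl , swap-segment s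
side-corners c (inj₂ (inj₂ (inj₁ s)))  = _ , _ , inj₂ refl , inj₁ refl , s
side-corners c (inj₂ (inj₂ (inj₂ s)))  = _ , _ , inj₁ refl , inj₁ refl , swap-segment s

same-segment-endpoints : ∀ {e p q p' q'} → SameSegment e (p , q) → SameSegment e (p' , q') →
  (p ≡ p' × q ≡ q') ⊎ (p ≡ q' × q ≡ p')
same-segment-endpoints (inj₁ (a , b)) (inj₁ (a' , b')) = inj₁ (trans (sym a) a' , trans (sym b) b')
same-segment-endpoints (inj₁ (a , b)) (inj₂ (a' , b')) = inj₂ (trans (sym a) a' , trans (sym b) b')
same-segment-endpoints (inj₂ (a , b)) (inj₁ (a' , b')) = inj₂ (trans (sym b) b' , trans (sym a) a')
same-segment-endpoints (inj₂ (a , b)) (inj₂ (a' , b')) = inj₁ (trans (sym b) b' , trans (sym a) a')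

record CrossedCorners (d c : Cell) : Set where
  field
    entry      : Point
    entry-P-c  : IsP c entry
    entry-Q-d  : IsQ d entry
    exit       : Point
    exit-Q-c   : IsQ c exit
    exit-P-d   : IsP d exit

-- If the shared edge joined the common P-corner to the common Q-corner,
-- the two cells would coincide.
crossed-corners : ∀ d c → ShareEdge d c → d ≢ c → CrossedCorners d c
crossed-corners d c (e , ed , ec) d≢c with side-corners d ed | side-corners c ec
... | p , q , pd , qd , s | p' , q' , pc , qc , s' with same-segment-endpoints s s'
... | inj₁ (refl , refl) = ⊥-elim (d≢c (same-corners⇒same-cell d c pd pc qd qc))
... | inj₂ (refl , refl) = record
  { entry = p' ; entry-P-c = pc ; entry-Q-d = qd
  ; exit  = q' ; exit-Q-c  = qc ; exit-P-d  = pd }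

-- A front stitch: one diagonal of a cell, traversed in one of two directions.
record Stitch : Set where
  constructor mk
  field
    cell    : Cell
    lower   : Bool
    forward : Bool
open Stitch

seg : Stitch → Segment
seg (mk c true  true)  = (bottomLeft c , topRight c)
seg (mk c true  false) = (topRight c , bottomLeft c)
seg (mk c false true)  = (bottomRight c , topLeft c)
seg (mk c false false) = (topLeft c , bottomRight c)

start end : Stitch → Point
start s = proj₁ (seg s)
end s = proj₂ (seg s)

Diag : Set
Diag = Cell × Bool

diagOf : Stitch → Diag
diagOf s = (cell s , lower s)

diagonal : Diag → Segment
diagonal (c , true)  = lowerDiag c
diagonal (c , false) = upperDiag c

diag-dec : (k k' : Diag) → Dec (k ≡ k')
diag-dec = ≡-dec (≡-dec ℤ._≟_ ℤ._≟_) BoolP._≟_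

stitch-diagonal : ∀ s → SameSegment (seg s) (diagonal (diagOf s))
stitch-diagonal (mk c true  true)  = inj₂ (refl , refl)
stitch-diagonal (mk c true  false) = inj₁ (refl , refl)
stitch-diagonal (mk c false true)  = inj₂ (refl , refl)
stitch-diagonal (mk c false false) = inj₁ (refl , refl)

lower-end-P : ∀ c o → IsP c (end (mk c true o))
lower-end-P c true  = inj₂ refl
lower-end-P c false = inj₁ refl

upper-start-Q : ∀ c o → IsQ c (start (mk c false o))
upper-start-Q c true  = inj₂ refl
upper-start-Q c false = inj₁ refl

lower-starting-at : ∀ c {p} → IsP c p → Σ Bool λ o → start (mk c true o) ≡ p
lower-starting-at c (inj₁ refl) = true , refl
lower-starting-at c (inj₂ refl) = false , refl

upper-ending-at : ∀ c {q} → IsQ c q → Σ Bool λ o → end (mk c false o) ≡ q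
upper-ending-at c (inj₁ refl) = true , refl
upper-ending-at c (inj₂ refl) = false , refl

private
  fst-≡ : ∀ {a b a' b' : ℤ} → (a , b) ≡ (a' , b') → a ≡ a'
  fst-≡ refl = refl
  snd-≡ : ∀ {a b a' b' : ℤ} → (a , b) ≡ (a' , b') → b ≡ b'
  snd-≡ refl = refl

topLeft-injective : ∀ c' c → topLeft c' ≡ topLeft c → c' ≡ c
topLeft-injective (a' , b') (a , b) e = cong₂ _,_ (fst-≡ e) (∙-cancelʳ (+ 1) b' b (snd-≡ e))

-- A stitch lies on the lower diagonal of c only if it is that diagonal:
-- any other match would make two coordinates differ by +1 and by -1.
on-lower⇒is-lower : ∀ s c → SameSegment (seg s) (lowerDiag c) → diagOf s ≡ (c , true)
on-lower⇒is-lower (mk (a' , b') true true) (a , b) (inj₁ (e , e'))   = ⊥-elim (not-both-successors a' a (fst-≡ e) (fst-≡ e'))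
on-lower⇒is-lower (mk c' true true) c (inj₂ (e , e'))                = cong (_, true) e
on-lower⇒is-lower (mk c' true false) c (inj₁ (e , e'))               = cong (_, true) e'
on-lower⇒is-lower (mk (a' , b') true false) (a , b) (inj₂ (e , e'))  = ⊥-elim (not-both-successors a' a (fst-≡ e') (fst-≡ e))
on-lower⇒is-lower (mk (a' , b') false true) (a , b) (inj₁ (e , e'))  = ⊥-elim (not-both-successors b' b (snd-≡ e) (snd-≡ e'))
on-lower⇒is-lower (mk (a' , b') false true) (a , b) (inj₂ (e , e'))  = ⊥-elim (not-both-successors a' a (fst-≡ e') (fst-≡ e))
on-lower⇒is-lower (mk (a' , b') false false) (a , b) (inj₁ (e , e')) = ⊥-elim (not-both-successors a' a (fst-≡ e) (fst-≡ e'))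
on-lower⇒is-lower (mk (a' , b') false false) (a , b) (inj₂ (e , e')) = ⊥-elim (not-both-successors b' b (snd-≡ e') (snd-≡ e))

on-upper⇒is-upper : ∀ s c → SameSegment (seg s) (upperDiag c) → diagOf s ≡ (c , false)
on-upper⇒is-upper (mk (a' , b') true true) (a , b) (inj₁ (e , e'))   = ⊥-elim (not-both-successors b' b (snd-≡ e) (snd-≡ e'))
on-upper⇒is-upper (mk (a' , b') true true) (a , b) (inj₂ (e , e'))   = ⊥-elim (not-both-successors a' a (fst-≡ e) (fst-≡ e'))
on-upper⇒is-upper (mk (a' , b') true false) (a , b) (inj₁ (e , e'))  = ⊥-elim (not-both-successors a' a (fst-≡ e') (fst-≡ e))
on-upper⇒is-upper (mk (a' , b') true false) (a , b) (inj₂ (e , e'))  = ⊥-elim (not-both-successors b' b (snd-≡ e') (snd-≡ e))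
on-upper⇒is-upper (mk (a' , b') false true) (a , b) (inj₁ (e , e'))  = ⊥-elim (not-both-successors a' a (fst-≡ e') (fst-≡ e))
on-upper⇒is-upper (mk c' false true) c (inj₂ (e , e'))               = cong (_, false) (topLeft-injective c' c e')
on-upper⇒is-upper (mk c' false false) c (inj₁ (e , e'))              = cong (_, false) (topLeft-injective c' c e)
on-upper⇒is-upper (mk (a' , b') false false) (a , b) (inj₂ (e , e')) = ⊥-elim (not-both-successors a' a (fst-≡ e) (fst-≡ e'))

on-diagonal⇒named : ∀ s k → SameSegment (seg s) (diagonal k) → diagOf s ≡ k
on-diagonal⇒named s (c , true)  = on-lower⇒is-lower s c
on-diagonal⇒named s (c , false) = on-upper⇒is-upper s c

insertAfter : ∀ {A : Set} {P : A → Set} (xs : List A) → Any P xs → List A → List A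
insertAfter (x ∷ xs) (here _)  ys = x ∷ ys ++ xs
insertAfter (x ∷ xs) (there p) ys = x ∷ insertAfter xs p ys

module _ {A : Set} {P Q : A → Set} where

  insertAfter⁺ˡ : ∀ xs (p : Any P xs) ys → Any Q xs → Any Q (insertAfter xs p ys)
  insertAfter⁺ˡ (x ∷ xs) (here _)  ys (here q)  = here q
  insertAfter⁺ˡ (x ∷ xs) (here _)  ys (there q) = there (AnyP.++⁺ʳ ys q)
  insertAfter⁺ˡ (x ∷ xs) (there p) ys (here q)  = here q
  insertAfter⁺ˡ (x ∷ xs) (there p) ys (there q) = there (insertAfter⁺ˡ xs p ys q)

  insertAfter⁺ʳ : ∀ xs (p : Any P xs) ys → Any Q ys → Any Q (insertAfter xs p ys)
  insertAfter⁺ʳ (x ∷ xs) (here _)  ys q = there (AnyP.++⁺ˡ q)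
  insertAfter⁺ʳ (x ∷ xs) (there p) ys q = there (insertAfter⁺ʳ xs p ys q)

  insertAfter⁻ : ∀ xs (p : Any P xs) ys → Any Q (insertAfter xs p ys) → Any Q xs ⊎ Any Q ys
  insertAfter⁻ (x ∷ xs) (here _)  ys (here q)  = inj₁ (here q)
  insertAfter⁻ (x ∷ xs) (here _)  ys (there q) = Sum.swap (Sum.map₂ there (AnyP.++⁻ ys q))
  insertAfter⁻ (x ∷ xs) (there p) ys (here q)  = inj₁ (here q)
  insertAfter⁻ (x ∷ xs) (there p) ys (there q) = Sum.map₁ there (insertAfter⁻ xs p ys q)

  insertAfter-All : ∀ xs (p : Any P xs) ys → All Q xs → All Q ys → All Q (insertAfter xs p ys)
  insertAfter-All (x ∷ xs) (here _)  ys (qx ∷ qxs) qys = qx ∷ AllP.++⁺ qys qxs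
  insertAfter-All (x ∷ xs) (there p) ys (qx ∷ qxs) qys = qx ∷ insertAfter-All xs p ys qxs qys

Follows : Stitch → Stitch → Set
Follows x y = Adjacent (end x) (start y) × (lower x ≡ true → IsQ (cell x) (start y))

data Threaded : List Stitch → Set where
  lastUpper : ∀ {x} → lower x ≡ false → Threaded (x ∷ [])
  link      : ∀ {x y xs} → Follows x y → Threaded (y ∷ xs) → Threaded (x ∷ y ∷ xs)

LowerFirst : List Diag → List Stitch → Set
LowerFirst seen []       = ⊤
LowerFirst seen (x ∷ xs) =
  (lower x ≡ false → (cell x , true) ∈ seen) × LowerFirst (diagOf x ∷ seen) xs

LowerFirst-mono : ∀ {seen seen'} xs → (∀ {k} → k ∈ seen → k ∈ seen') →
  LowerFirst seen xs → LowerFirst seen' xs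
LowerFirst-mono []       sub _        = tt
LowerFirst-mono (x ∷ xs) sub (hx , h) = (λ up → sub (hx up)) , LowerFirst-mono xs extend h
  where
    extend : ∀ {k} → k ∈ diagOf x ∷ _ → k ∈ diagOf x ∷ _
    extend (here e)  = here e
    extend (there m) = there (sub m)

DistinctDiags : List Stitch → Set
DistinctDiags = AllPairs (λ x y → diagOf x ≢ diagOf y)

Contains : Diag → List Stitch → Set
Contains k = Any (λ y → diagOf y ≡ k)

contains? : ∀ k xs → Dec (Contains k xs)
contains? k = any? (λ y → diag-dec (diagOf y) k)

not-contained : ∀ {k} xs → ¬ Contains k xs → All (λ y → k ≢ diagOf y) xs
not-contained []       ¬c = []
not-contained (x ∷ xs) ¬c = (λ e → ¬c (here (sym e))) ∷ not-contained xs (λ c → ¬c (there c))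

lower-then-upper : ∀ c oL oU → Follows (mk c true oL) (mk c false oU)
lower-then-upper c oL oU =
  P-Q-adjacent c (lower-end-P c oL) (upper-start-Q c oU) , λ _ → upper-start-Q c oU

private
  true≢false : ∀ {b} → b ≡ true → b ≡ false → ⊥
  true≢false refl ()

module Insertion {d c : Cell} (corners : CrossedCorners d c) where
  open CrossedCorners corners

  Lc Uc : Stitch
  Lc = mk c true  (proj₁ (lower-starting-at c entry-P-c))
  Uc = mk c false (proj₁ (upper-ending-at c exit-Q-c))

  block : List Stitch
  block = Lc ∷ Uc ∷ []

  -- The block fits between the lower diagonal x of d and its successor y:
  -- x ends at a P-corner of d and Lc starts at entry, a Q-corner of d;
  -- Uc ends at exit, a P-corner of d, and y starts at a Q-corner of d.
  block-fits : ∀ x y → diagOf x ≡ (d , true) → Follows x y →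
    Follows x Lc × Follows Lc Uc × Follows Uc y
  block-fits (mk .d .true o) y refl (_ , y-Q) =
    (P-Q-adjacent d (lower-end-P d o) Lc-Q , λ _ → Lc-Q) ,
    lower-then-upper c (forward Lc) (forward Uc) ,
    (P-Q-adjacent d Uc-P (y-Q refl) , λ ())
    where
      Lc-Q : IsQ d (start Lc)
      Lc-Q = subst (IsQ d) (sym (proj₂ (lower-starting-at c entry-P-c))) entry-Q-d
      Uc-P : IsP d (end Uc)
      Uc-P = subst (IsP d) (sym (proj₂ (upper-ending-at c exit-Q-c))) exit-P-d

  insert : (xs : List Stitch) → Contains (d , true) xs → List Stitch
  insert xs hd = insertAfter xs hd block

  -- Insertion keeps each invariant of tours: linking, closing, distinctness
  -- (c was absent) and the lower-before-upper order (Lc precedes Uc).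
  threaded-insert : ∀ xs hd → Threaded xs → Threaded (insert xs hd)
  threaded-insert (x ∷ [])     (here e) (lastUpper up) = ⊥-elim (true≢false (cong proj₂ e) up)
  threaded-insert (x ∷ y ∷ ys) (here e) (link x→y t) with block-fits x y e x→y
  ... | x→Lc , Lc→Uc , Uc→y = link x→Lc (link Lc→Uc (link Uc→y t))
  threaded-insert (x ∷ y ∷ ys) (there hd@(here _))  (link x→y t) = link x→y (threaded-insert (y ∷ ys) hd t)
  threaded-insert (x ∷ y ∷ ys) (there hd@(there _)) (link x→y t) = link x→y (threaded-insert (y ∷ ys) hd t)

  -- The last stitch of a tour is an upper diagonal, so it is not the insertion
  -- point and stays last.
  lastOf-insert : ∀ s xs hd → Threaded xs → lastOf s (map seg (insert xs hd)) ≡ lastOf s (map seg xs)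
  lastOf-insert s (x ∷ [])     (here e)   (lastUpper up) = ⊥-elim (true≢false (cong proj₂ e) up)
  lastOf-insert s (x ∷ y ∷ ys) (here e)   t              = refl
  lastOf-insert s (x ∷ y ∷ ys) (there hd) (link _ t)     = lastOf-insert (seg x) (y ∷ ys) hd t

  closes-insert : ∀ xs hd → Threaded xs → Closes (map seg xs) → Closes (map seg (insert xs hd))
  closes-insert (x ∷ xs) hd@(here _)  t cl =
    subst (λ z → Adjacent (proj₂ z) (start x)) (sym (lastOf-insert (seg x) (x ∷ xs) hd t)) cl
  closes-insert (x ∷ xs) hd@(there _) t cl =
    subst (λ z → Adjacent (proj₂ z) (start x)) (sym (lastOf-insert (seg x) (x ∷ xs) hd t)) cl

  distinct-insert : ∀ xs hd → DistinctDiags xs →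
    All (λ y → (c , true) ≢ diagOf y) xs → All (λ y → (c , false) ≢ diagOf y) xs →
    DistinctDiags (insert xs hd)
  distinct-insert (x ∷ xs) (here _) (x∉ ∷ u) (L≢x ∷ L∉) (U≢x ∷ U∉) =
    (≢-sym L≢x ∷ ≢-sym U≢x ∷ x∉) ∷ ((λ ()) ∷ L∉) ∷ U∉ ∷ u
  distinct-insert (x ∷ xs) (there hd) (x∉ ∷ u) (L≢x ∷ L∉) (U≢x ∷ U∉) =
    insertAfter-All xs hd block x∉ (≢-sym L≢x ∷ ≢-sym U≢x ∷ []) ∷ distinct-insert xs hd u L∉ U∉

  lowerFirst-insert : ∀ seen xs hd → LowerFirst seen xs → LowerFirst seen (insert xs hd)
  lowerFirst-insert seen (x ∷ xs) (here _) (hx , h) =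
    hx , (λ ()) , (λ _ → here refl) , LowerFirst-mono xs (λ m → there (there m)) h
  lowerFirst-insert seen (x ∷ xs) (there hd) (hx , h) =
    hx , lowerFirst-insert (diagOf x ∷ seen) xs hd h

module Growth (C : Configuration) where

  record Tour : Set where
    field
      stitches   : List Stitch
      threaded   : Threaded stitches
      closes     : Closes (map seg stitches)
      distinct   : DistinctDiags stitches
      lowerFirst : LowerFirst [] stitches
      inC        : All (λ s → cell s ∈ cells C) stitches
      paired     : ∀ {c b} → Contains (c , b) stitches → Contains (c , not b) stitches
  open Tour public

  Visits : Tour → Cell → Set
  Visits T c = Contains (c , true) (stitches T)

  _⊑_ : Tour → Tour → Set
  T ⊑ T' = ∀ {c} → Visits T c → Visits T' c

  singleton : ∀ {r} → r ∈ cells C → Tour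
  singleton {r} r∈C = record
    { stitches   = mk r true true ∷ mk r false true ∷ []
    ; threaded   = link (lower-then-upper r true true) (lastUpper refl)
    ; closes     = Q-P-adjacent r (inj₁ refl) (inj₁ refl)
    ; distinct   = ((λ ()) ∷ []) ∷ [] ∷ []
    ; lowerFirst = (λ ()) , (λ _ → here refl) , tt
    ; inC        = r∈C ∷ r∈C ∷ []
    ; paired     = λ { (here refl) → there (here refl)
                     ; (there (here refl)) → here refl
                     ; (there (there ())) }
    }

  extend : (T : Tour) {d c : Cell} → Visits T d → ¬ Visits T c → Step4 C d c →
    Σ Tour λ T' → Visits T' c × T ⊑ T'
  extend T {d} {c} hd ¬hc (_ , c∈C , shared) =
    T' , insertAfter⁺ʳ xs hd block (here refl) , insertAfter⁺ˡ xs hd block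
    where
      xs = stitches T
      d≢c : d ≢ c
      d≢c refl = ¬hc hd
      open Insertion (crossed-corners d c shared d≢c)
      ¬hU : ¬ Contains (c , false) xs
      ¬hU h = ¬hc (paired T h)
      paired' : ∀ {z b} → Contains (z , b) (insert xs hd) → Contains (z , not b) (insert xs hd)
      paired' h with insertAfter⁻ xs hd block h
      ... | inj₁ old                 = insertAfter⁺ˡ xs hd block (paired T old)
      ... | inj₂ (here refl)         = insertAfter⁺ʳ xs hd block (there (here refl))
      ... | inj₂ (there (here refl)) = insertAfter⁺ʳ xs hd block (here refl)
      T' : Tour
      T' = record
        { stitches   = insert xs hd
        ; threaded   = threaded-insert xs hd (threaded T)
        ; closes     = closes-insert xs hd (threaded T) (closes T)
        ; distinct   = distinct-insert xs hd (distinct T) (not-contained xs ¬hc) (not-contained xs ¬hU)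
        ; lowerFirst = lowerFirst-insert [] xs hd (lowerFirst T)
        ; inC        = insertAfter-All xs hd block (inC T) (c∈C ∷ c∈C ∷ [])
        ; paired     = paired'
        }

  follow : (T : Tour) {x y : Cell} → Visits T x → Star (Step4 C) x y →
    Σ Tour λ T' → Visits T' y × T ⊑ T'
  follow T hx ε = T , hx , λ h → h
  follow T hx (_◅_ {j = z} step path) with contains? (z , true) (stitches T)
  ... | yes hz = follow T hz path
  ... | no ¬hz with extend T hx ¬hz step
  ...   | T₁ , hz , T⊑T₁ with follow T₁ hz path
  ...     | T₂ , hy , T₁⊑T₂ = T₂ , hy , λ h → T₁⊑T₂ (T⊑T₁ h)

  visit-all : FourConnected C → ∀ {r} → r ∈ cells C → (T : Tour) → Visits T r →
    (qs : List Cell) → All (_∈ cells C) qs → Σ Tour λ T' → All (Visits T') qs × T ⊑ T'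
  visit-all conn r∈C T hr []       []            = T , [] , λ h → h
  visit-all conn r∈C T hr (q ∷ qs) (q∈C ∷ qs∈C) with follow T hr (conn r∈C q∈C)
  ... | T₁ , hq , T⊑T₁ with visit-all conn r∈C T₁ (T⊑T₁ hr) qs qs∈C
  ...   | T₂ , hqs , T₁⊑T₂ = T₂ , T₁⊑T₂ hq ∷ hqs , λ h → T₁⊑T₂ (T⊑T₁ h)

  covering-tour : FourConnected C → ∀ {r} → r ∈ cells C → Σ Tour λ T → All (Visits T) (cells C)
  covering-tour conn r∈C with visit-all conn r∈C (singleton r∈C) (here refl) (cells C) (All.tabulate (λ m → m))
  ... | T , covers , _ = T , covers

lookup-map : ∀ {A B : Set} (f : A → B) xs (i : Fin (length (map f xs))) →
  lookup (map f xs) i ≡ f (lookup xs (cast (length-map f xs) i))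
lookup-map f (x ∷ xs) Fin.zero    = refl
lookup-map f (x ∷ xs) (Fin.suc i) = lookup-map f xs i

distinct-lookup : ∀ {A B : Set} (f : A → B) xs → AllPairs (λ x y → f x ≢ f y) xs →
  ∀ i j → f (lookup xs i) ≡ f (lookup xs j) → i ≡ j
distinct-lookup f (x ∷ xs) _            Fin.zero    Fin.zero    _ = refl
distinct-lookup f (x ∷ xs) (x∉ ∷ _)     Fin.zero    (Fin.suc j) e = ⊥-elim (All.lookup x∉ (∈-lookup j) e)
distinct-lookup f (x ∷ xs) (x∉ ∷ _)     (Fin.suc i) Fin.zero    e = ⊥-elim (All.lookup x∉ (∈-lookup i) (sym e))
distinct-lookup f (x ∷ xs) (_ ∷ unique) (Fin.suc i) (Fin.suc j) e = cong Fin.suc (distinct-lookup f xs unique i j e)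

lowerFirst-lookup : ∀ {c} seen xs (j : Fin (length xs)) → LowerFirst seen xs →
  diagOf (lookup xs j) ≡ (c , false) →
  (c , true) ∈ seen ⊎ ∃[ k ] (toℕ k < toℕ j × diagOf (lookup xs k) ≡ (c , true))
lowerFirst-lookup seen (mk _ _ _ ∷ xs) Fin.zero    (hx , _) refl = inj₁ (hx refl)
lowerFirst-lookup seen (x ∷ xs)         (Fin.suc j) (_ , h)  e with lowerFirst-lookup (diagOf x ∷ seen) xs j h e
... | inj₁ (here e')          = inj₂ (Fin.zero , s≤s z≤n , sym e')
... | inj₁ (there m)          = inj₁ m
... | inj₂ (k , k<j , lower-k) = inj₂ (Fin.suc k , s≤s k<j , lower-k)

∈-remove : ∀ {A : Set} {k x : A} us {vs} → k ∈ us ++ x ∷ vs → k ≢ x → k ∈ us ++ vs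
∈-remove []       (here e)  k≢x = ⊥-elim (k≢x e)
∈-remove []       (there m) k≢x = m
∈-remove (u ∷ us) (here e)  k≢x = here e
∈-remove (u ∷ us) (there m) k≢x = there (∈-remove us m k≢x)

length-middle : ∀ {A : Set} {x : A} us {vs} → length (us ++ x ∷ vs) ≡ suc (length (us ++ vs))
length-middle []       = refl
length-middle (u ∷ us) = cong suc (length-middle us)

unique-⊆⇒length≤ : ∀ {A : Set} {xs ys : List A} → Unique xs → (∀ {k} → k ∈ xs → k ∈ ys) →
  length xs ≤ length ys
unique-⊆⇒length≤ {xs = []}     _          _   = z≤n
unique-⊆⇒length≤ {xs = x ∷ xs} (x∉ ∷ u) xs⊆ys with ∈-∃++ (xs⊆ys (here refl))
... | us , vs , refl = subst (suc (length xs) ≤_) (sym (length-middle us))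
  (s≤s (unique-⊆⇒length≤ u λ m → ∈-remove us (xs⊆ys (there m)) (λ e → All.lookup x∉ m (sym e))))

diagonalsOf : List Cell → List Diag
diagonalsOf []       = []
diagonalsOf (c ∷ cs) = (c , true) ∷ (c , false) ∷ diagonalsOf cs

length-diagonalsOf : ∀ cs → length (diagonalsOf cs) ≡ 2 ℕ.* length cs
length-diagonalsOf []       = refl
length-diagonalsOf (c ∷ cs) =
  trans (cong (λ n → suc (suc n)) (length-diagonalsOf cs)) (sym (ℕP.*-suc 2 (length cs)))

∈-diagonalsOf⁺ : ∀ {c b} cs → c ∈ cs → (c , b) ∈ diagonalsOf cs
∈-diagonalsOf⁺ {b = true}  (c ∷ cs) (here refl) = here refl
∈-diagonalsOf⁺ {b = false} (c ∷ cs) (here refl) = there (here refl)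
∈-diagonalsOf⁺             (c ∷ cs) (there m)   = there (there (∈-diagonalsOf⁺ cs m))

∈-diagonalsOf⁻ : ∀ {c b} cs → (c , b) ∈ diagonalsOf cs → c ∈ cs
∈-diagonalsOf⁻ (c ∷ cs) (here refl)         = here refl
∈-diagonalsOf⁻ (c ∷ cs) (there (here refl)) = here refl
∈-diagonalsOf⁻ (c ∷ cs) (there (there m))   = there (∈-diagonalsOf⁻ cs m)

∉-diagonalsOf : ∀ {c} b cs → All (c ≢_) cs → All ((c , b) ≢_) (diagonalsOf cs)
∉-diagonalsOf b []        []          = []
∉-diagonalsOf b (c' ∷ cs) (c≢c' ∷ c∉) =
  (λ e → c≢c' (cong proj₁ e)) ∷ (λ e → c≢c' (cong proj₁ e)) ∷ ∉-diagonalsOf b cs c∉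

unique-diagonalsOf : ∀ cs → Unique cs → Unique (diagonalsOf cs)
unique-diagonalsOf []       []         = []
unique-diagonalsOf (c ∷ cs) (c∉ ∷ u) =
  ((λ ()) ∷ ∉-diagonalsOf true cs c∉) ∷ ∉-diagonalsOf false cs c∉ ∷ unique-diagonalsOf cs u

threaded⇒unit : ∀ {xs} → Threaded xs → UnitBackStitches (map seg xs)
threaded⇒unit (lastUpper _) = [-]
threaded⇒unit (link x→y t)  = proj₁ x→y ∷ threaded⇒unit t

unit⇒nondegenerate : ∀ {S} → UnitBackStitches S → Linked (λ s t → proj₂ s ≢ proj₁ t) S
unit⇒nondegenerate = Linked.map λ {s} {t} adj e →
  adjacent-irreflexive (proj₁ t) (subst (λ z → Adjacent z (proj₁ t)) e adj)

lower-or-upper : ∀ {e} k → SameSegment e (diagonal k) →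
  SameSegment e (lowerDiag (proj₁ k)) ⊎ SameSegment e (upperDiag (proj₁ k))
lower-or-upper (c , true)  = inj₁
lower-or-upper (c , false) = inj₂

module Extraction (C : Configuration) (T : Growth.Tour C) (covers : All (Growth.Visits C T) (cells C)) where
  open Growth C

  xs : List Stitch
  xs = stitches T

  S : List Segment
  S = map seg xs

  contains-all : ∀ {c} b → c ∈ cells C → Contains (c , b) xs
  contains-all true  c∈C = All.lookup covers c∈C
  contains-all false c∈C = paired T (All.lookup covers c∈C)

  length-tour : length xs ≡ 2 ℕ.* size C
  length-tour = ℕP.≤-antisym
    (subst₂ _≤_ (length-map diagOf xs) (length-diagonalsOf (cells C))
      (unique-⊆⇒length≤ (AllPairsP.map⁺ (distinct T)) named⊆diagonals))
    (subst₂ _≤_ (length-diagonalsOf (cells C)) (length-map diagOf xs)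
      (unique-⊆⇒length≤ (unique-diagonalsOf (cells C) (proj₂ C)) diagonals⊆named))
    where
      named⊆diagonals : ∀ {k} → k ∈ map diagOf xs → k ∈ diagonalsOf (cells C)
      named⊆diagonals m with ∈-map⁻ diagOf m
      ... | s , s∈xs , refl = ∈-diagonalsOf⁺ (cells C) (All.lookup (inC T) s∈xs)
      diagonals⊆named : ∀ {k} → k ∈ diagonalsOf (cells C) → k ∈ map diagOf xs
      diagonals⊆named {c , b} m =
        AnyP.map⁺ (Any.map sym (contains-all b (∈-diagonalsOf⁻ (cells C) m)))

  ι : Fin (length S) → Fin (length xs)
  ι = cast (length-map seg xs)

  ι-injective : ∀ i j → ι i ≡ ι j → i ≡ j
  ι-injective i j e = toℕ-injective (trans (sym (toℕ-cast _ i)) (trans (cong toℕ e) (toℕ-cast _ j)))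

  named-at : ∀ i k → SameSegment (lookup S i) (diagonal k) → diagOf (lookup xs (ι i)) ≡ k
  named-at i k on-k = on-diagonal⇒named (lookup xs (ι i)) k
    (subst (λ z → SameSegment z (diagonal k)) (lookup-map seg xs i) on-k)

  position-unique : ∀ {k} i j → SameSegment (lookup S i) (diagonal k) →
    SameSegment (lookup S j) (diagonal k) → i ≡ j
  position-unique {k} i j on-i on-j = ι-injective i j
    (distinct-lookup diagOf xs (distinct T) (ι i) (ι j) (trans (named-at i k on-i) (sym (named-at j k on-j))))

  occurs-once : ∀ k → Contains k xs →
    ∃[ i ] (SameSegment (lookup S i) (diagonal k) × (∀ j → SameSegment (lookup S j) (diagonal k) → j ≡ i))
  occurs-once k h = i , on-i , λ j on-j → position-unique {k} j i on-j on-i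
    where
      i : Fin (length S)
      i = cast (sym (length-map seg xs)) (Any.index h)
      on-i : SameSegment (lookup S i) (diagonal k)
      ιi≡index : ι i ≡ Any.index h
      ιi≡index = cast-involutive (length-map seg xs) (sym (length-map seg xs)) (Any.index h)
      on-i = subst₂ (λ z k' → SameSegment z (diagonal k'))
        (sym (trans (lookup-map seg xs i) (cong (λ j → seg (lookup xs j)) ιi≡index)))
        (lookup-index h)
        (stitch-diagonal (lookup xs (Any.index h)))

  lower-before-upper : ∀ c (i j : Fin (length S)) →
    SameSegment (lookup S i) (lowerDiag c) → SameSegment (lookup S j) (upperDiag c) → toℕ i < toℕ j
  lower-before-upper c i j on-i on-j
    with lowerFirst-lookup [] xs (ι j) (lowerFirst T) (named-at j (c , false) on-j)
  ... | inj₂ (k , k<ιj , lower-k) =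
    subst₂ _<_ (trans (cong toℕ k≡ιi) (toℕ-cast _ i)) (toℕ-cast _ j) k<ιj
    where
      k≡ιi : k ≡ ι i
      k≡ιi = distinct-lookup diagOf xs (distinct T) k (ι i) (trans lower-k (sym (named-at i (c , true) on-i)))

  embroidery : IsEmbroidery C S
  embroidery = record
    { len               = trans (length-map seg xs) length-tour
    ; stitchIsDiagonal  = λ i → let s = lookup xs (ι i) in
        cell s , All.lookup (inC T) (∈-lookup (ι i)) ,
        lower-or-upper (diagOf s)
          (subst (λ z → SameSegment z (diagonal (diagOf s))) (sym (lookup-map seg xs i)) (stitch-diagonal s))
    ; lowerOnce         = λ c c∈C → occurs-once (c , true) (contains-all true c∈C)
    ; upperOnce         = λ c c∈C → occurs-once (c , false) (contains-all false c∈C)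
    ; backNonDegenerate = unit⇒nondegenerate (threaded⇒unit (threaded T))
    ; lowerBeforeUpper  = λ c _ → lower-before-upper c
    }

  strong-embroidery : StronglyEmbroiderable C
  strong-embroidery = S , embroidery , threaded⇒unit (threaded T) , closes T

strong⇒embroiderable : ∀ {C} → StronglyEmbroiderable C → Embroiderable C
strong⇒embroiderable (S , emb , unit , _) = S , emb , unit

mainTheorem1 : (C : Configuration) → size C ≥ 1 → FourConnected C →
    StronglyEmbroiderable C × Embroiderable C
mainTheorem1 ([] , _) () _
mainTheorem1 C@((r ∷ _) , _) _ conn = strong , strong⇒embroiderable strong
  where
    open Growth C using (covering-tour)
    strong : StronglyEmbroiderable C
    strong with covering-tour conn (here refl)
    ... | T , covers = Extraction.strong-embroidery C T covers
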